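{- Let $n,\ell\geq 1$ and let $\mathcal{V}$ be a homogeneous subspace of $\mathbb{C}[X]$, where $X=(x_{ij})_{1\le i\le \ell,\,1\le j\le n}$. Then $\boldsymbol{\mathcal{E}}(\boldsymbol{\mathcal{D}}(\mathcal{V}))=\boldsymbol{\mathcal{D}}(\boldsymbol{\mathcal{E}}(\mathcal{V}))$.
   Context: $X=(x_{ij})$ is an $\ell\times n$ matrix of independent commuting variables and $\mathbb{C}[X]$ is graded by vector degree in $\mathbb{N}^\ell$ (the variable $x_{ij}$ has degree the $i$-th unit vector); a subspace is homogeneous if it is the direct sum of its intersections with the homogeneous components. Write $\partial_{ij}=\partial/\partial x_{ij}$. The generalized polarization operators are $E_{i,k}^{(p)}=\sum_{j=1}^n x_{ij}\,\partial_{kj}^{\,p}$ for $1\le i,k\le \ell$ and $p\ge 1$. A subspace is closed under derivatives if it is stable under every $\partial_{ij}$, and closed under polarization if it is stable under every $E_{i,k}^{(p)}$. $\boldsymbol{\mathcal{D}}(\mathcal{V})$ denotes the smallest subspace of $\mathbb{C}[X]$ closed under derivatives containing $\mathcal{V}$, and $\boldsymbol{\mathcal{E}}(\mathcal{V})$ the smallest subspace closed under polarization containing $\mathcal{V}$. -}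

module Defs where

open import Level using (Level; _⊔_) renaming (suc to lsuc)
open import Algebra.Bundles using (CommutativeRing)
open import Data.Nat as ℕ using (ℕ; zero; suc; pred)
open import Data.Fin as Fin using (Fin)
open import Data.Fin.Properties using (all?)
open import Data.Nat.ListAction using (sum)
open import Data.List as List using (List; []; _∷_; _++_; map; concatMap; filter; foldr; allFin)
open import Data.Product using (_×_; _,_; ∃)
open import Data.Bool using (if_then_else_; _∧_)
open import Relation.Nullary using (¬_; Dec; does)
open import Relation.Binary.PropositionalEquality using (_≡_)

-- Fields of characteristic zero (ℂ is the intended instance)

natMul : {c r : Level} (R : CommutativeRing c r) → ℕ → CommutativeRing.Carrier R → CommutativeRing.Carrier R
natMul R zero    x = CommutativeRing.0# R
natMul R (suc k) x = CommutativeRing._+_ R x (natMul R k x)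

record CharZeroField (c r : Level) : Set (lsuc (c ⊔ r)) where
  field
    commRing : CommutativeRing c r
  open CommutativeRing commRing public hiding (ring)
  field
    0≉1     : ¬ (0# ≈ 1#)
    inverse : ∀ x → ¬ (x ≈ 0#) → ∃ λ y → (x * y) ≈ 1#
    char0   : ∀ k → ¬ (natMul commRing (suc k) 1# ≈ 0#)

module Poly {c r : Level} (F : CharZeroField c r) (ℓ n : ℕ) where
  open CharZeroField F

  _·ℕ_ : ℕ → Carrier → Carrier
  _·ℕ_ = natMul commRing

  -- exponent matrix of a monomial  Π x_ij ^ (m i j)
  Mon : Set
  Mon = Fin ℓ → Fin n → ℕ

  _≟M_ : (m m′ : Mon) → Dec (∀ i j → m i j ≡ m′ i j)
  m ≟M m′ = all? (λ i → all? (λ j → m i j ℕ.≟ m′ i j))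

  -- a polynomial is a finite formal sum of terms  c · x^m
  Polynomial : Set c
  Polynomial = List (Carrier × Mon)

  coeff : Polynomial → Mon → Carrier
  coeff []             m = 0#
  coeff ((a , m′) ∷ f) m = if does (m′ ≟M m) then a + coeff f m else coeff f m

  _≈P_ : Polynomial → Polynomial → Set r
  f ≈P g = ∀ m → coeff f m ≈ coeff g m

  0P : Polynomial
  0P = []

  _+P_ : Polynomial → Polynomial → Polynomial
  _+P_ = _++_

  _·P_ : Carrier → Polynomial → Polynomial
  a ·P f = map (λ { (b , m) → (a * b , m) }) f

  isIJ : Fin ℓ → Fin n → Fin ℓ → Fin n → _
  isIJ i j i′ j′ = does (i Fin.≟ i′) ∧ does (j Fin.≟ j′)

  ∂ : Fin ℓ → Fin n → Polynomial → Polynomial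
  ∂ i j = map λ { (a , m) →
    (m i j ·ℕ a , λ i′ j′ → if isIJ i j i′ j′ then pred (m i′ j′) else m i′ j′) }

  ∂^ : ℕ → Fin ℓ → Fin n → Polynomial → Polynomial
  ∂^ zero    i j f = f
  ∂^ (suc p) i j f = ∂ i j (∂^ p i j f)

  x· : Fin ℓ → Fin n → Polynomial → Polynomial
  x· i j = map λ { (a , m) →
    (a , λ i′ j′ → if isIJ i j i′ j′ then suc (m i′ j′) else m i′ j′) }

  E : Fin ℓ → Fin ℓ → ℕ → Polynomial → Polynomial
  E i k p f = concatMap (λ j → x· i j (∂^ p k j f)) (allFin n)

  deg : Mon → Fin ℓ → ℕ
  deg m i = sum (map (m i) (allFin n))

  component : (Fin ℓ → ℕ) → Polynomial → Polynomial
  component d = filter (λ { (a , m) → all? (λ i → deg m i ℕ.≟ d i) })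

  -- subspaces are predicates on polynomials
  record IsSubspace {a : Level} (V : Polynomial → Set a) : Set (c ⊔ r ⊔ a) where
    field
      resp : ∀ {f g} → f ≈P g → V f → V g
      zero∈ : V 0P
      +∈ : ∀ {f g} → V f → V g → V (f +P g)
      ·∈ : ∀ a {f} → V f → V (a ·P f)

  -- homogeneous: the direct sum of its intersections with the homogeneous
  -- components, i.e. contains every homogeneous component of its elements
  IsHomogeneous : {a : Level} → (Polynomial → Set a) → Set (c ⊔ a)
  IsHomogeneous V = ∀ f → V f → ∀ d → V (component d f)

  data 𝓓 {a : Level} (V : Polynomial → Set a) : Polynomial → Set (c ⊔ r ⊔ a) where
    incl  : ∀ {f} → V f → 𝓓 V f
    resp  : ∀ {f g} → f ≈P g → 𝓓 V f → 𝓓 V g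
    zero∈ : 𝓓 V 0P
    +∈    : ∀ {f g} → 𝓓 V f → 𝓓 V g → 𝓓 V (f +P g)
    ·∈    : ∀ a {f} → 𝓓 V f → 𝓓 V (a ·P f)
    ∂∈    : ∀ i j {f} → 𝓓 V f → 𝓓 V (∂ i j f)

  data 𝓔 {a : Level} (V : Polynomial → Set a) : Polynomial → Set (c ⊔ r ⊔ a) where
    incl  : ∀ {f} → V f → 𝓔 V f
    resp  : ∀ {f g} → f ≈P g → 𝓔 V f → 𝓔 V g
    zero∈ : 𝓔 V 0P
    +∈    : ∀ {f g} → 𝓔 V f → 𝓔 V g → 𝓔 V (f +P g)
    ·∈    : ∀ a {f} → 𝓔 V f → 𝓔 V (a ·P f)
    E∈    : ∀ i k p {f} → 1 ℕ.≤ p → 𝓔 V f → 𝓔 V (E i k p f)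

module Submission where

-- The whole argument rests on one commutation relation (Leibniz rule):
--
--     ∂_ab ∘ E_{i,k}^{(p)}  =  E_{i,k}^{(p)} ∘ ∂_ab  +  δ_{ai} ∂_kb^p ,
--
-- which follows from  ∂_ab x_ij = x_ij ∂_ab + δ_{(a,b),(i,j)}  and the
-- commutativity of the derivatives.  Hence the commutator of a derivative with a
-- polarization operator is again a pure derivative, and:
--   * if X is closed under E, so is 𝓓(X)   (induction over 𝓓(X), carrying g and E g);
--   * if Y is closed under all ∂, so is 𝓔(Y)  (induction over 𝓔(Y), carrying all
--     iterated derivatives of g).
-- The theorem follows from these two facts and the minimality of 𝓓 and 𝓔.

open import Defs
open import Level using (Level; _⊔_)
open import Algebra.Bundles using (CommutativeRing)
open import Data.Nat as ℕ using (ℕ; zero; suc; pred; _≤_)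
import Data.Nat.Properties as ℕₚ
open import Data.Fin as Fin using (Fin)
open import Data.List using (List; []; _∷_; _++_; map; concatMap; concat; allFin; tabulate; replicate)
open import Data.List.Properties using (map-++; map-tabulate; map-concatMap; ++-identityʳ)
open import Data.Product using (_×_; _,_; proj₂)
open import Data.Bool using (Bool; true; false; if_then_else_; _∧_)
open import Data.Bool.Properties using (∧-zeroʳ)
open import Data.Empty using (⊥-elim)
open import Function using (_∘_; _⇔_; mk⇔; Equivalence)
open import Relation.Nullary using (¬_; Dec; does; yes; no)
open import Relation.Nullary.Decidable using (dec-true; dec-false)
open import Relation.Binary.Bundles using (Setoid)
open import Relation.Binary.PropositionalEquality as ≡ using (_≡_)
import Relation.Binary.Reasoning.Setoid as SetoidReasoning

module Development {c r : Level} (F : CharZeroField c r) (ℓ n : ℕ) where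
  open CharZeroField F hiding (zero)
  open Poly F ℓ n

  -- ℕ-multiples k ·ℕ x.  Defs defines them by its own recursion, which agrees
  -- with the library's repeated addition _×ᴿ_, so the library laws transfer.
  module Multiples where
    open import Algebra.Properties.Semiring.Mult semiring
      using (×-congʳ; ×-congˡ; ×-assocˡ; ×-comm-*) renaming (_×_ to _×ᴿ_)
    open import Algebra.Properties.CommutativeMonoid.Mult +-commutativeMonoid
      using (×-distrib-+)

    ·ℕ≡×ᴿ : ∀ k x → k ·ℕ x ≡ k ×ᴿ x
    ·ℕ≡×ᴿ zero    x = ≡.refl
    ·ℕ≡×ᴿ (suc k) x = ≡.cong (x +_) (·ℕ≡×ᴿ k x)

    ·ℕ-cong : ∀ k {x y} → x ≈ y → k ·ℕ x ≈ k ·ℕ y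
    ·ℕ-cong k {x} {y} x≈y rewrite ·ℕ≡×ᴿ k x | ·ℕ≡×ᴿ k y = ×-congʳ k x≈y

    ·ℕ-distrib-+ : ∀ k x y → k ·ℕ (x + y) ≈ k ·ℕ x + k ·ℕ y
    ·ℕ-distrib-+ k x y rewrite ·ℕ≡×ᴿ k (x + y) | ·ℕ≡×ᴿ k x | ·ℕ≡×ᴿ k y = ×-distrib-+ x y k

    ·ℕ-comm-* : ∀ k a x → k ·ℕ (a * x) ≈ a * (k ·ℕ x)
    ·ℕ-comm-* k a x rewrite ·ℕ≡×ᴿ k (a * x) | ·ℕ≡×ᴿ k x = sym (×-comm-* k a x)

    ·ℕ-swap : ∀ j k x → j ·ℕ (k ·ℕ x) ≈ k ·ℕ (j ·ℕ x)
    ·ℕ-swap j k x rewrite ·ℕ≡×ᴿ k x | ·ℕ≡×ᴿ j x | ·ℕ≡×ᴿ j (k ×ᴿ x) | ·ℕ≡×ᴿ k (j ×ᴿ x) =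
      trans (×-assocˡ x j k) (trans (×-congˡ (ℕₚ.*-comm j k)) (sym (×-assocˡ x k j)))

    ·ℕ-zeroʳ : ∀ k → k ·ℕ 0# ≈ 0#
    ·ℕ-zeroʳ k = trans (·ℕ-cong k (sym (zeroˡ 0#))) (trans (·ℕ-comm-* k 0# 0#) (zeroˡ _))

  open Multiples

  -- Polynomial equality (equal coefficients), wrapped in a record so that the two
  -- polynomials can be inferred.
  infix 4 _≋_
  record _≋_ (f g : Polynomial) : Set r where
    constructor mk≋
    field coeff≈ : f ≈P g
  open _≋_ public

  ≋-setoid : Setoid c r
  ≋-setoid = record
    { Carrier = Polynomial
    ; _≈_ = _≋_
    ; isEquivalence = record
      { refl  = mk≋ λ _ → refl
      ; sym   = λ f≋g → mk≋ λ m → sym (coeff≈ f≋g m)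
      ; trans = λ f≋g g≋h → mk≋ λ m → trans (coeff≈ f≋g m) (coeff≈ g≋h m) } }

  open Setoid ≋-setoid public using ()
    renaming (refl to ≋-refl; sym to ≋-sym; trans to ≋-trans; reflexive to ≡⇒≋)
  module ≈-Reasoning = SetoidReasoning setoid
  module ≋-Reasoning = SetoidReasoning ≋-setoid

  _≐_ : Mon → Mon → Set
  m ≐ m′ = ∀ i j → m i j ≡ m′ i j

  ≐-refl : ∀ {m} → m ≐ m
  ≐-refl i j = ≡.refl

  ≐-sym : ∀ {m m′} → m ≐ m′ → m′ ≐ m
  ≐-sym m≐m′ i j = ≡.sym (m≐m′ i j)

  ≐-trans : ∀ {m m′ m″} → m ≐ m′ → m′ ≐ m″ → m ≐ m″
  ≐-trans m≐m′ m′≐m″ i j = ≡.trans (m≐m′ i j) (m′≐m″ i j)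

  monomial : Carrier → Mon → Polynomial
  monomial a m = (a , m) ∷ []

  coeff-∷ : ∀ a m₀ f m → coeff ((a , m₀) ∷ f) m ≈ coeff (monomial a m₀) m + coeff f m
  coeff-∷ a m₀ f m = by-cases (m₀ ≟M m)
    where
    by-cases : (d : Dec (m₀ ≐ m)) →
      (if does d then a + coeff f m else coeff f m) ≈ (if does d then a + 0# else 0#) + coeff f m
    by-cases (yes _) = +-congʳ (sym (+-identityʳ a))
    by-cases (no _)  = sym (+-identityˡ _)

  monomial-hit : ∀ a {m₀ m} → m₀ ≐ m → coeff (monomial a m₀) m ≈ a
  monomial-hit a {m₀} {m} m₀≐m =
    trans (reflexive (≡.cong (λ b → if b then a + 0# else 0#) (dec-true (m₀ ≟M m) m₀≐m))) (+-identityʳ a)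

  monomial-miss : ∀ a {m₀ m} → ¬ (m₀ ≐ m) → coeff (monomial a m₀) m ≈ 0#
  monomial-miss a {m₀} {m} m₀≭m =
    reflexive (≡.cong (λ b → if b then a + 0# else 0#) (dec-false (m₀ ≟M m) m₀≭m))

  monomial-transfer : ∀ a {m₀ m m₀′ m′} → (m₀ ≐ m ⇔ m₀′ ≐ m′) →
    coeff (monomial a m₀) m ≈ coeff (monomial a m₀′) m′
  monomial-transfer a {m₀} {m} hit⇔ with m₀ ≟M m
  ... | yes hit = trans (monomial-hit a hit) (sym (monomial-hit a (Equivalence.to hit⇔ hit)))
  ... | no miss = trans (monomial-miss a miss) (sym (monomial-miss a (miss ∘ Equivalence.from hit⇔)))

  coeff-++ : ∀ f g m → coeff (f ++ g) m ≈ coeff f m + coeff g m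
  coeff-++ []             g m = sym (+-identityˡ _)
  coeff-++ ((a , m₀) ∷ f) g m = begin
    coeff ((a , m₀) ∷ f ++ g) m                  ≈⟨ coeff-∷ a m₀ (f ++ g) m ⟩
    coeff (monomial a m₀) m + coeff (f ++ g) m   ≈⟨ +-congˡ (coeff-++ f g m) ⟩
    coeff (monomial a m₀) m + (coeff f m + coeff g m) ≈⟨ sym (+-assoc _ _ _) ⟩
    (coeff (monomial a m₀) m + coeff f m) + coeff g m ≈⟨ +-congʳ (sym (coeff-∷ a m₀ f m)) ⟩
    coeff ((a , m₀) ∷ f) m + coeff g m           ∎
    where open ≈-Reasoning

  coeff-· : ∀ a f m → coeff (a ·P f) m ≈ a * coeff f m
  coeff-· a []             m = sym (zeroʳ a)
  coeff-· a ((b , m₀) ∷ f) m = begin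
    coeff ((a * b , m₀) ∷ a ·P f) m                    ≈⟨ coeff-∷ (a * b) m₀ (a ·P f) m ⟩
    coeff (monomial (a * b) m₀) m + coeff (a ·P f) m   ≈⟨ +-cong (monomial-· m₀≟m) (coeff-· a f m) ⟩
    a * coeff (monomial b m₀) m + a * coeff f m        ≈⟨ sym (distribˡ a _ _) ⟩
    a * (coeff (monomial b m₀) m + coeff f m)          ≈⟨ *-congˡ (sym (coeff-∷ b m₀ f m)) ⟩
    a * coeff ((b , m₀) ∷ f) m                         ∎
    where
    open ≈-Reasoning
    m₀≟m = m₀ ≟M m
    monomial-· : (d : Dec (m₀ ≐ m)) → coeff (monomial (a * b) m₀) m ≈ a * coeff (monomial b m₀) m
    monomial-· (yes hit)  = trans (monomial-hit (a * b) hit) (*-congˡ (sym (monomial-hit b hit)))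
    monomial-· (no miss) = trans (monomial-miss (a * b) miss) (sym (trans (*-congˡ (monomial-miss b miss)) (zeroʳ a)))

  ++-cong : ∀ {f f′ g g′} → f ≋ f′ → g ≋ g′ → f ++ g ≋ f′ ++ g′
  ++-cong {f} {f′} {g} {g′} f≋f′ g≋g′ = mk≋ λ m →
    trans (coeff-++ f g m) (trans (+-cong (coeff≈ f≋f′ m) (coeff≈ g≋g′ m)) (sym (coeff-++ f′ g′ m)))

  ++-interchange : ∀ f g f′ g′ → (f ++ g) ++ (f′ ++ g′) ≋ (f ++ f′) ++ (g ++ g′)
  ++-interchange f g f′ g′ = mk≋ λ m → begin
    coeff ((f ++ g) ++ (f′ ++ g′)) m                        ≈⟨ coeff-++ (f ++ g) _ m ⟩
    coeff (f ++ g) m + coeff (f′ ++ g′) m                   ≈⟨ +-cong (coeff-++ f g m) (coeff-++ f′ g′ m) ⟩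
    (coeff f m + coeff g m) + (coeff f′ m + coeff g′ m)     ≈⟨ interchange _ _ _ _ ⟩
    (coeff f m + coeff f′ m) + (coeff g m + coeff g′ m)     ≈⟨ sym (+-cong (coeff-++ f f′ m) (coeff-++ g g′ m)) ⟩
    coeff (f ++ f′) m + coeff (g ++ g′) m                   ≈⟨ sym (coeff-++ (f ++ f′) _ m) ⟩
    coeff ((f ++ f′) ++ (g ++ g′)) m                        ∎
    where
    open ≈-Reasoning
    open import Algebra.Properties.CommutativeSemigroup +-commutativeSemigroup using (interchange)

  ·-zero : ∀ f → 0# ·P f ≋ []
  ·-zero f = mk≋ λ m → trans (coeff-· 0# f m) (zeroˡ _)

  ++-cancel : ∀ f d → (f ++ d) ++ (- 1#) ·P d ≋ f
  ++-cancel f d = mk≋ λ m → begin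
    coeff ((f ++ d) ++ (- 1#) ·P d) m                    ≈⟨ coeff-++ (f ++ d) _ m ⟩
    coeff (f ++ d) m + coeff ((- 1#) ·P d) m             ≈⟨ +-cong (coeff-++ f d m) (coeff-· (- 1#) d m) ⟩
    (coeff f m + coeff d m) + (- 1#) * coeff d m         ≈⟨ +-congˡ (-1*x≈-x _) ⟩
    (coeff f m + coeff d m) + - coeff d m                ≈⟨ +-assoc _ _ _ ⟩
    coeff f m + (coeff d m + - coeff d m)                ≈⟨ +-congˡ (-‿inverseʳ _) ⟩
    coeff f m + 0#                                       ≈⟨ +-identityʳ _ ⟩
    coeff f m                                            ∎
    where
    open ≈-Reasoning
    open import Algebra.Properties.Ring (CommutativeRing.ring commRing) using (-1*x≈-x)

  monomial-cong : ∀ {a b m m′} → a ≈ b → m ≐ m′ → monomial a m ≋ monomial b m′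
  monomial-cong {a} {b} {m} {m′} a≈b m≐m′ = mk≋ λ m″ → by-cases m″ (m ≟M m″)
    where
    by-cases : ∀ m″ → Dec (m ≐ m″) → coeff (monomial a m) m″ ≈ coeff (monomial b m′) m″
    by-cases m″ (yes hit)  = trans (monomial-hit a hit)
      (trans a≈b (sym (monomial-hit b (≐-trans (≐-sym m≐m′) hit))))
    by-cases m″ (no miss) = trans (monomial-miss a miss)
      (sym (monomial-miss b λ hit → miss (≐-trans m≐m′ hit)))

  monomial-zero : ∀ {a} m → a ≈ 0# → monomial a m ≋ []
  monomial-zero {a} m a≈0 = mk≋ λ m′ → by-cases m′ (m ≟M m′)
    where
    by-cases : ∀ m′ → Dec (m ≐ m′) → coeff (monomial a m) m′ ≈ 0#
    by-cases m′ (yes hit)  = trans (monomial-hit a hit) a≈0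
    by-cases m′ (no miss) = monomial-miss a miss

  monomial-+ : ∀ a b m → monomial a m ++ monomial b m ≋ monomial (a + b) m
  monomial-+ a b m = mk≋ λ m′ → trans (coeff-++ (monomial a m) (monomial b m) m′) (by-cases m′ (m ≟M m′))
    where
    by-cases : ∀ m′ → Dec (m ≐ m′) → coeff (monomial a m) m′ + coeff (monomial b m) m′ ≈ coeff (monomial (a + b) m) m′
    by-cases m′ (yes hit)  = trans (+-cong (monomial-hit a hit) (monomial-hit b hit)) (sym (monomial-hit (a + b) hit))
    by-cases m′ (no miss) = trans (+-cong (monomial-miss a miss) (monomial-miss b miss))
      (trans (+-identityʳ 0#) (sym (monomial-miss (a + b) miss)))

  map-map-cong : ∀ {τ σ τ′ σ′ : Carrier × Mon → Carrier × Mon} →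
    (∀ t → τ (σ t) ∷ [] ≋ τ′ (σ′ t) ∷ []) → ∀ f → map τ (map σ f) ≋ map τ′ (map σ′ f)
  map-map-cong agree []      = ≋-refl
  map-map-cong agree (t ∷ f) = ++-cong (agree t) (map-map-cong agree f)

  upd : Fin ℓ → Fin n → (ℕ → ℕ) → Mon → Mon
  upd i j h m i′ j′ = if isIJ i j i′ j′ then h (m i′ j′) else m i′ j′

  record Apart (i : Fin ℓ) (j : Fin n) (i′ : Fin ℓ) (j′ : Fin n) : Set where
    constructor apart
    field isIJ≡false : isIJ i j i′ j′ ≡ false

  data Position (i : Fin ℓ) (j : Fin n) : Fin ℓ → Fin n → Set where
    here      : Position i j i j
    elsewhere : ∀ {i′ j′} → Apart i j i′ j′ → Position i j i′ j′

  position : ∀ i j i′ j′ → Position i j i′ j′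
  position i j i′ j′ with i Fin.≟ i′ | j Fin.≟ j′
  ... | yes ≡.refl | yes ≡.refl = here
  ... | yes _      | no j≢j′    = elsewhere (apart
    (≡.trans (≡.cong (does (i Fin.≟ i′) ∧_) (dec-false (j Fin.≟ j′) j≢j′)) (∧-zeroʳ _)))
  ... | no i≢i′    | _          = elsewhere (apart
    (≡.cong (_∧ does (j Fin.≟ j′)) (dec-false (i Fin.≟ i′) i≢i′)))

  isIJ-refl : ∀ i j → isIJ i j i j ≡ true
  isIJ-refl i j = ≡.cong₂ _∧_ (dec-true (i Fin.≟ i) ≡.refl) (dec-true (j Fin.≟ j) ≡.refl)

  apart-irrefl : ∀ {i j} → ¬ Apart i j i j
  apart-irrefl {i} {j} (apart ij≢ij) with ≡.trans (≡.sym (isIJ-refl i j)) ij≢ij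
  ... | ()

  apart-sym : ∀ {i j i′ j′} → Apart i j i′ j′ → Apart i′ j′ i j
  apart-sym {i} {j} {i′} {j′} ij≢ with position i′ j′ i j
  ... | here           = ⊥-elim (apart-irrefl ij≢)
  ... | elsewhere ij≢′ = ij≢′

  upd-here : ∀ i j h m → upd i j h m i j ≡ h (m i j)
  upd-here i j h m = ≡.cong (λ b → if b then h (m i j) else m i j) (isIJ-refl i j)

  upd-elsewhere : ∀ {i j i′ j′} h m → Apart i j i′ j′ → upd i j h m i′ j′ ≡ m i′ j′
  upd-elsewhere {i′ = i′} {j′} h m (apart ij≢) = ≡.cong (λ b → if b then h (m i′ j′) else m i′ j′) ij≢

  upd-cong : ∀ i j h {m m′} → m ≐ m′ → upd i j h m ≐ upd i j h m′
  upd-cong i j h m≐m′ i′ j′ = ≡.cong (λ x → if isIJ i j i′ j′ then h x else x) (m≐m′ i′ j′)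

  pred-upd-suc : ∀ i j m → upd i j pred (upd i j suc m) ≐ m
  pred-upd-suc i j m i′ j′ with position i j i′ j′
  ... | here          = ≡.trans (upd-here i j pred (upd i j suc m)) (≡.cong pred (upd-here i j suc m))
  ... | elsewhere ij≢ = ≡.trans (upd-elsewhere pred (upd i j suc m) ij≢) (upd-elsewhere suc m ij≢)

  suc-upd-pred : ∀ i j m {k} → m i j ≡ suc k → upd i j suc (upd i j pred m) ≐ m
  suc-upd-pred i j m {k} positive i′ j′ with position i j i′ j′
  ... | here          = ≡.trans (upd-here i j suc (upd i j pred m))
    (≡.trans (≡.cong suc (upd-here i j pred m)) (≡.trans (≡.cong (suc ∘ pred) positive) (≡.sym positive)))
  ... | elsewhere ij≢ = ≡.trans (upd-elsewhere suc (upd i j pred m) ij≢) (upd-elsewhere pred m ij≢)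

  upd-comm : ∀ {a b i j} g h m → Apart a b i j →
    upd a b g (upd i j h m) ≐ upd i j h (upd a b g m)
  upd-comm {a} {b} {i} {j} g h m ab≢ij i′ j′ with position a b i′ j′ | position i j i′ j′
  ... | here          | here          = ⊥-elim (apart-irrefl ab≢ij)
  ... | here          | elsewhere ij≢ = begin
    upd a b g (upd i j h m) a b ≡⟨ upd-here a b g (upd i j h m) ⟩
    g (upd i j h m a b)       ≡⟨ ≡.cong g (upd-elsewhere h m ij≢) ⟩
    g (m a b)                 ≡⟨ upd-here a b g m ⟨
    upd a b g m a b           ≡⟨ upd-elsewhere h (upd a b g m) ij≢ ⟨
    upd i j h (upd a b g m) a b ∎
    where open ≡.≡-Reasoning
  ... | elsewhere ab≢ | here          = begin
    upd a b g (upd i j h m) i j ≡⟨ upd-elsewhere g (upd i j h m) ab≢ ⟩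
    upd i j h m i j           ≡⟨ upd-here i j h m ⟩
    h (m i j)                 ≡⟨ ≡.cong h (upd-elsewhere g m ab≢) ⟨
    h (upd a b g m i j)       ≡⟨ upd-here i j h (upd a b g m) ⟨
    upd i j h (upd a b g m) i j ∎
    where open ≡.≡-Reasoning
  ... | elsewhere ab≢ | elsewhere ij≢ = begin
    upd a b g (upd i j h m) i′ j′ ≡⟨ upd-elsewhere g (upd i j h m) ab≢ ⟩
    upd i j h m i′ j′           ≡⟨ upd-elsewhere h m ij≢ ⟩
    m i′ j′                     ≡⟨ upd-elsewhere g m ab≢ ⟨
    upd a b g m i′ j′           ≡⟨ upd-elsewhere h (upd a b g m) ij≢ ⟨
    upd i j h (upd a b g m) i′ j′ ∎
    where open ≡.≡-Reasoning

  record IsAdditive (h : Carrier → Carrier) : Set (c ⊔ r) where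
    field
      cong   : ∀ {x y} → x ≈ y → h x ≈ h y
      0-homo : h 0# ≈ 0#
      +-homo : ∀ x y → h (x + y) ≈ h x + h y

  ·ℕ-additive : ∀ k → IsAdditive (k ·ℕ_)
  ·ℕ-additive k = record { cong = ·ℕ-cong k ; 0-homo = ·ℕ-zeroʳ k ; +-homo = ·ℕ-distrib-+ k }

  ifPositive : ℕ → Carrier → Carrier
  ifPositive zero    x = 0#
  ifPositive (suc k) x = x

  ifPositive-additive : ∀ k → IsAdditive (ifPositive k)
  ifPositive-additive zero    = record { cong = λ _ → refl ; 0-homo = refl ; +-homo = λ _ _ → sym (+-identityʳ 0#) }
  ifPositive-additive (suc k) = record { cong = λ x≈y → x≈y ; 0-homo = refl ; +-homo = λ _ _ → refl }

  coeff-map : ∀ {τ : Carrier × Mon → Carrier × Mon} {h} → IsAdditive h → ∀ m m′ →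
    (∀ t → coeff (τ t ∷ []) m ≈ h (coeff (t ∷ []) m′)) →
    ∀ f → coeff (map τ f) m ≈ h (coeff f m′)
  coeff-map {τ} {h} additive m m′ on-terms []      = sym (IsAdditive.0-homo additive)
  coeff-map {τ} {h} additive m m′ on-terms (t ∷ f) = begin
    coeff (τ t ∷ map τ f) m                  ≈⟨ coeff-++ (τ t ∷ []) (map τ f) m ⟩
    coeff (τ t ∷ []) m + coeff (map τ f) m   ≈⟨ +-cong (on-terms t) (coeff-map additive m m′ on-terms f) ⟩
    h (coeff (t ∷ []) m′) + h (coeff f m′)   ≈⟨ sym (IsAdditive.+-homo additive _ _) ⟩
    h (coeff (t ∷ []) m′ + coeff f m′)       ≈⟨ IsAdditive.cong additive (sym (coeff-++ (t ∷ []) f m′)) ⟩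
    h (coeff (t ∷ f) m′)                     ∎
    where open ≈-Reasoning

  -- A term of ∂_ij(α x^m₀) hits x^m only if m₀ = m + e_ij, except when the
  -- exponent of x_ij in m₀ is 0, in which case the term vanishes.
  ∂-monomial-miss : ∀ i j α {m₀ m} → ¬ (m₀ ≐ upd i j suc m) → coeff (∂ i j (monomial α m₀)) m ≈ 0#
  ∂-monomial-miss i j α {m₀} {m} miss with upd i j pred m₀ ≟M m
  ... | no miss′ = monomial-miss (m₀ i j ·ℕ α) miss′
  ... | yes hit = trans (monomial-hit (m₀ i j ·ℕ α) hit) (reflexive (≡.cong (_·ℕ α) (exponent-zero (m₀ i j) ≡.refl)))
    where
    exponent-zero : ∀ e → m₀ i j ≡ e → m₀ i j ≡ 0
    exponent-zero zero    exponent = exponent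
    exponent-zero (suc k) exponent =
      ⊥-elim (miss (≐-trans (≐-sym (suc-upd-pred i j m₀ exponent)) (upd-cong i j suc hit)))

  coeff-∂-monomial : ∀ i j α m₀ m →
    coeff (∂ i j (monomial α m₀)) m ≈ suc (m i j) ·ℕ coeff (monomial α m₀) (upd i j suc m)
  coeff-∂-monomial i j α m₀ m with m₀ ≟M upd i j suc m
  ... | yes hit = begin
    coeff (∂ i j (monomial α m₀)) m        ≈⟨ monomial-hit (m₀ i j ·ℕ α) (≐-trans (upd-cong i j pred hit) (pred-upd-suc i j m)) ⟩
    m₀ i j ·ℕ α                            ≡⟨ ≡.cong (_·ℕ α) (≡.trans (hit i j) (upd-here i j suc m)) ⟩
    suc (m i j) ·ℕ α                       ≈⟨ ·ℕ-cong (suc (m i j)) (sym (monomial-hit α hit)) ⟩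
    suc (m i j) ·ℕ coeff (monomial α m₀) (upd i j suc m) ∎
    where open ≈-Reasoning
  ... | no miss = trans (∂-monomial-miss i j α miss)
    (sym (trans (·ℕ-cong (suc (m i j)) (monomial-miss α miss)) (·ℕ-zeroʳ (suc (m i j)))))

  coeff-x·-monomial : ∀ i j α m₀ m →
    coeff (x· i j (monomial α m₀)) m ≈ ifPositive (m i j) (coeff (monomial α m₀) (upd i j pred m))
  coeff-x·-monomial i j α m₀ m with m i j in exponent
  ... | zero  = monomial-miss α λ hit → ℕₚ.1+n≢0 (≡.trans (≡.sym (upd-here i j suc m₀)) (≡.trans (hit i j) exponent))
  ... | suc k = monomial-transfer α (mk⇔
    (λ hit → ≐-trans (≐-sym (pred-upd-suc i j m₀)) (upd-cong i j pred hit))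
    (λ hit → ≐-trans (upd-cong i j suc hit) (suc-upd-pred i j m exponent)))

  coeff-∂ : ∀ i j f m → coeff (∂ i j f) m ≈ suc (m i j) ·ℕ coeff f (upd i j suc m)
  coeff-∂ i j f m = coeff-map (·ℕ-additive (suc (m i j))) m (upd i j suc m)
    (λ { (α , m₀) → coeff-∂-monomial i j α m₀ m }) f

  coeff-x· : ∀ i j f m → coeff (x· i j f) m ≈ ifPositive (m i j) (coeff f (upd i j pred m))
  coeff-x· i j f m = coeff-map (ifPositive-additive (m i j)) m (upd i j pred m)
    (λ { (α , m₀) → coeff-x·-monomial i j α m₀ m }) f

  record IsLinear (T : Polynomial → Polynomial) : Set (c ⊔ r) where
    field
      cong-≋ : ∀ {f g} → f ≋ g → T f ≋ T g
      hom-++ : ∀ f g → T (f ++ g) ≋ T f ++ T g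
      hom-·  : ∀ a f → T (a ·P f) ≋ a ·P T f
  open IsLinear public

  linear-[] : ∀ {T} → IsLinear T → T [] ≋ []
  linear-[] {T} linear = ≋-trans (hom-· linear 0# []) (·-zero (T []))

  map-linear : ∀ {τ : Carrier × Mon → Carrier × Mon} (h : Mon → Carrier → Carrier) (σ : Mon → Mon) →
    (∀ m {x y} → x ≈ y → h m x ≈ h m y) →
    (∀ f m → coeff (map τ f) m ≈ h m (coeff f (σ m))) →
    (∀ a f → map τ (a ·P f) ≋ a ·P map τ f) →
    IsLinear (map τ)
  map-linear h σ h-cong formula scalar = record
    { cong-≋ = λ {f} {g} f≋g → mk≋ λ m →
        trans (formula f m) (trans (h-cong m (coeff≈ f≋g (σ m))) (sym (formula g m)))
    ; hom-++ = λ f g → ≡⇒≋ (map-++ _ f g)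
    ; hom-·  = scalar }

  ∂-linear : ∀ i j → IsLinear (∂ i j)
  ∂-linear i j = map-linear (λ m → suc (m i j) ·ℕ_) (upd i j suc) (λ m → ·ℕ-cong (suc (m i j))) (coeff-∂ i j)
    (λ a → map-map-cong λ { (b , m) → monomial-cong (·ℕ-comm-* (m i j) a b) ≐-refl })

  x·-linear : ∀ i j → IsLinear (x· i j)
  x·-linear i j = map-linear (λ m → ifPositive (m i j)) (upd i j pred) (λ m → IsAdditive.cong (ifPositive-additive (m i j)))
    (coeff-x· i j) (λ a → map-map-cong λ _ → ≋-refl)

  id-linear : IsLinear (λ f → f)
  id-linear = record { cong-≋ = λ f≋g → f≋g ; hom-++ = λ _ _ → ≋-refl ; hom-· = λ _ _ → ≋-refl }

  ∘-linear : ∀ {T U} → IsLinear T → IsLinear U → IsLinear (λ f → T (U f))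
  ∘-linear {T} {U} T-lin U-lin = record
    { cong-≋ = λ f≋g → cong-≋ T-lin (cong-≋ U-lin f≋g)
    ; hom-++ = λ f g → ≋-trans (cong-≋ T-lin (hom-++ U-lin f g)) (hom-++ T-lin (U f) (U g))
    ; hom-·  = λ a f → ≋-trans (cong-≋ T-lin (hom-· U-lin a f)) (hom-· T-lin a (U f)) }

  ++-linear : ∀ {T U} → IsLinear T → IsLinear U → IsLinear (λ f → T f ++ U f)
  ++-linear {T} {U} T-lin U-lin = record
    { cong-≋ = λ f≋g → ++-cong (cong-≋ T-lin f≋g) (cong-≋ U-lin f≋g)
    ; hom-++ = λ f g → ≋-trans (++-cong (hom-++ T-lin f g) (hom-++ U-lin f g)) (++-interchange (T f) (T g) (U f) (U g))
    ; hom-·  = λ a f → ≋-trans (++-cong (hom-· T-lin a f) (hom-· U-lin a f)) (≡⇒≋ (≡.sym (map-++ _ (T f) (U f)))) }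

  concatMap-linear : ∀ {A : Set} (T : A → Polynomial → Polynomial) → (∀ j → IsLinear (T j)) →
    ∀ js → IsLinear (λ f → concatMap (λ j → T j f) js)
  concatMap-linear T T-lin []       = record { cong-≋ = λ _ → ≋-refl ; hom-++ = λ _ _ → ≋-refl ; hom-· = λ _ _ → ≋-refl }
  concatMap-linear T T-lin (j ∷ js) = ++-linear (T-lin j) (concatMap-linear T T-lin js)

  ∂^-linear : ∀ p i j → IsLinear (∂^ p i j)
  ∂^-linear zero    i j = id-linear
  ∂^-linear (suc p) i j = ∘-linear (∂-linear i j) (∂^-linear p i j)

  E-linear : ∀ i k p → IsLinear (E i k p)
  E-linear i k p = concatMap-linear (λ j f → x· i j (∂^ p k j f)) (λ j → ∘-linear (x·-linear i j) (∂^-linear p k j)) (allFin n)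

  linear-ext : ∀ {T U} → IsLinear T → IsLinear U → (∀ α m → T (monomial α m) ≋ U (monomial α m)) →
    ∀ f → T f ≋ U f
  linear-ext T-lin U-lin on-monomials []            = ≋-trans (linear-[] T-lin) (≋-sym (linear-[] U-lin))
  linear-ext {T} {U} T-lin U-lin on-monomials ((α , m) ∷ f) = begin
    T (monomial α m ++ f)         ≈⟨ hom-++ T-lin (monomial α m) f ⟩
    T (monomial α m) ++ T f       ≈⟨ ++-cong (on-monomials α m) (linear-ext T-lin U-lin on-monomials f) ⟩
    U (monomial α m) ++ U f       ≈⟨ hom-++ U-lin (monomial α m) f ⟨
    U (monomial α m ++ f)         ∎
    where open ≋-Reasoning

  ∂-x·-same : ∀ i j f → ∂ i j (x· i j f) ≋ x· i j (∂ i j f) ++ f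
  ∂-x·-same i j = linear-ext (∘-linear (∂-linear i j) (x·-linear i j))
    (++-linear (∘-linear (x·-linear i j) (∂-linear i j)) id-linear)
    (λ α m → on-monomial α m (m i j) ≡.refl)
    where
    on-monomial : ∀ α m e → m i j ≡ e →
      ∂ i j (x· i j (monomial α m)) ≋ x· i j (∂ i j (monomial α m)) ++ monomial α m
    on-monomial α m zero exponent = begin
      monomial (upd i j suc m i j ·ℕ α) (upd i j pred (upd i j suc m))
        ≈⟨ monomial-cong (trans (reflexive (≡.cong (_·ℕ α) (≡.trans (upd-here i j suc m) (≡.cong suc exponent))))
                                (+-identityʳ α))
                         (pred-upd-suc i j m) ⟩
      monomial α m
        ≈⟨ ++-cong (monomial-zero _ (reflexive (≡.cong (_·ℕ α) exponent))) ≋-refl ⟨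
      monomial (m i j ·ℕ α) (upd i j suc (upd i j pred m)) ++ monomial α m ∎
      where open ≋-Reasoning
    on-monomial α m (suc k) exponent = begin
      monomial (upd i j suc m i j ·ℕ α) (upd i j pred (upd i j suc m))
        ≈⟨ monomial-cong (reflexive (≡.cong (_·ℕ α) (upd-here i j suc m))) (pred-upd-suc i j m) ⟩
      monomial (α + m i j ·ℕ α) m
        ≈⟨ monomial-cong (+-comm α _) ≐-refl ⟩
      monomial (m i j ·ℕ α + α) m
        ≈⟨ monomial-+ (m i j ·ℕ α) α m ⟨
      monomial (m i j ·ℕ α) m ++ monomial α m
        ≈⟨ ++-cong (monomial-cong refl (≐-sym (suc-upd-pred i j m exponent))) ≋-refl ⟩
      monomial (m i j ·ℕ α) (upd i j suc (upd i j pred m)) ++ monomial α m ∎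
      where open ≋-Reasoning

  ∂-x·-apart : ∀ {a b i j} → Apart a b i j → ∀ f → ∂ a b (x· i j f) ≋ x· i j (∂ a b f)
  ∂-x·-apart {a} {b} {i} {j} ab≢ij = map-map-cong λ { (α , m) → monomial-cong
    (reflexive (≡.cong (_·ℕ α) (upd-elsewhere suc m (apart-sym ab≢ij))))
    (upd-comm pred suc m ab≢ij) }

  ∂-x· : ∀ a b i j f → ∂ a b (x· i j f) ≋ x· i j (∂ a b f) ++ (if isIJ a b i j then f else [])
  ∂-x· a b i j f with position a b i j
  ... | here = ≋-trans (∂-x·-same a b f)
    (≡⇒≋ (≡.cong (λ t → x· a b (∂ a b f) ++ (if t then f else [])) (≡.sym (isIJ-refl a b))))
  ... | elsewhere ab≢ij = ≋-trans (∂-x·-apart ab≢ij f)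
    (≡⇒≋ (≡.trans (≡.sym (++-identityʳ _))
      (≡.cong (λ t → x· i j (∂ a b f) ++ (if t then f else [])) (≡.sym (Apart.isIJ≡false ab≢ij)))))

  ∂-comm : ∀ a b k j f → ∂ a b (∂ k j f) ≋ ∂ k j (∂ a b f)
  ∂-comm a b k j f with position a b k j
  ... | here            = ≋-refl
  ... | elsewhere ab≢kj = map-map-cong (λ { (α , m) → monomial-cong
    (begin
      upd k j pred m a b ·ℕ (m k j ·ℕ α)   ≡⟨ ≡.cong (_·ℕ (m k j ·ℕ α)) (upd-elsewhere pred m (apart-sym ab≢kj)) ⟩
      m a b ·ℕ (m k j ·ℕ α)                ≈⟨ ·ℕ-swap (m a b) (m k j) α ⟩
      m k j ·ℕ (m a b ·ℕ α)                ≡⟨ ≡.cong (_·ℕ (m a b ·ℕ α)) (upd-elsewhere pred m ab≢kj) ⟨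
      upd a b pred m k j ·ℕ (m a b ·ℕ α)   ∎)
    (upd-comm pred pred m ab≢kj) }) f
    where open ≈-Reasoning

  ∂-∂^-comm : ∀ p a b k j f → ∂ a b (∂^ p k j f) ≋ ∂^ p k j (∂ a b f)
  ∂-∂^-comm zero    a b k j f = ≋-refl
  ∂-∂^-comm (suc p) a b k j f =
    ≋-trans (∂-comm a b k j (∂^ p k j f)) (cong-≋ (∂-linear k j) (∂-∂^-comm p a b k j f))

  concatMap-cong : ∀ {A : Set} {h h′ : A → Polynomial} → (∀ j → h j ≋ h′ j) → ∀ js →
    concatMap h js ≋ concatMap h′ js
  concatMap-cong h≋h′ []       = ≋-refl
  concatMap-cong h≋h′ (j ∷ js) = ++-cong (h≋h′ j) (concatMap-cong h≋h′ js)

  concatMap-++ : ∀ {A : Set} (g h : A → Polynomial) js →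
    concatMap (λ j → g j ++ h j) js ≋ concatMap g js ++ concatMap h js
  concatMap-++ g h []       = ≋-refl
  concatMap-++ g h (j ∷ js) = ≋-trans (++-cong (≋-refl {g j ++ h j}) (concatMap-++ g h js))
    (++-interchange (g j) (h j) (concatMap g js) (concatMap h js))

  sum-zero : ∀ m → concat (tabulate {n = m} (λ _ → [] {A = Carrier × Mon})) ≡ []
  sum-zero zero    = ≡.refl
  sum-zero (suc m) = sum-zero m

  sum-select : ∀ {m} (b : Fin m) (g : Fin m → Polynomial) →
    concat (tabulate (λ j → if does (b Fin.≟ j) then g j else [])) ≡ g b
  sum-select {suc m} Fin.zero    g = ≡.trans (≡.cong (g Fin.zero ++_) (sum-zero m)) (++-identityʳ _)
  sum-select {suc m} (Fin.suc b) g = sum-select b (g ∘ Fin.suc)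

  sum-kronecker : ∀ a i b (g : Fin n → Polynomial) →
    concatMap (λ j → if isIJ a b i j then g j else []) (allFin n) ≡ (if does (a Fin.≟ i) then g b else [])
  sum-kronecker a i b g with a Fin.≟ i
  ... | yes ≡.refl = ≡.trans (≡.cong concat (map-tabulate {n = n} (λ j → j) (λ j → if does (b Fin.≟ j) then g j else [])))
                          (sum-select b g)
  ... | no _       = ≡.trans (≡.cong concat (map-tabulate {n = n} (λ j → j) (λ _ → []))) (sum-zero n)

  correction : (a i : Fin ℓ) (b : Fin n) (k : Fin ℓ) (p : ℕ) → Polynomial → Polynomial
  correction a i b k p f = if does (a Fin.≟ i) then ∂^ p k b f else []

  correction-elim : ∀ {q} (P : Polynomial → Set q) a i b k p f → P (∂^ p k b f) → P [] →
    P (correction a i b k p f)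
  correction-elim P a i b k p f P-∂^ P-[] = by-cases (does (a Fin.≟ i))
    where
    by-cases : ∀ (t : Bool) → P (if t then ∂^ p k b f else [])
    by-cases true  = P-∂^
    by-cases false = P-[]

  ∂-E : ∀ a b i k p f → ∂ a b (E i k p f) ≋ E i k p (∂ a b f) ++ correction a i b k p f
  ∂-E a b i k p f = begin
    ∂ a b (concatMap (λ j → x· i j (∂^ p k j f)) (allFin n))
      ≡⟨ map-concatMap _ _ (allFin n) ⟩
    concatMap (λ j → ∂ a b (x· i j (∂^ p k j f))) (allFin n)
      ≈⟨ concatMap-cong (λ j → ≋-trans (∂-x· a b i j (∂^ p k j f))
           (++-cong (cong-≋ (x·-linear i j) (∂-∂^-comm p a b k j f)) ≋-refl)) (allFin n) ⟩
    concatMap (λ j → x· i j (∂^ p k j (∂ a b f)) ++ (if isIJ a b i j then ∂^ p k j f else [])) (allFin n)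
      ≈⟨ concatMap-++ (λ j → x· i j (∂^ p k j (∂ a b f))) (λ j → if isIJ a b i j then ∂^ p k j f else []) (allFin n) ⟩
    E i k p (∂ a b f) ++ concatMap (λ j → if isIJ a b i j then ∂^ p k j f else []) (allFin n)
      ≡⟨ ≡.cong (E i k p (∂ a b f) ++_) (sum-kronecker a i b (λ j → ∂^ p k j f)) ⟩
    E i k p (∂ a b f) ++ correction a i b k p f
      ∎
    where open ≋-Reasoning

  𝓓-isSubspace : ∀ {v} (V : Polynomial → Set v) → IsSubspace (𝓓 V)
  𝓓-isSubspace V = record { resp = resp ; zero∈ = zero∈ ; +∈ = +∈ ; ·∈ = ·∈ }

  𝓔-isSubspace : ∀ {v} (V : Polynomial → Set v) → IsSubspace (𝓔 V)
  𝓔-isSubspace V = record { resp = resp ; zero∈ = zero∈ ; +∈ = +∈ ; ·∈ = ·∈ }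

  module _ {v w} {V : Polynomial → Set v} {W : Polynomial → Set w} (W-subspace : IsSubspace W) where
    private module Sub = IsSubspace W-subspace

    𝓓-minimal : (∀ i j {f} → W f → W (∂ i j f)) → (∀ {f} → V f → W f) → ∀ {f} → 𝓓 V f → W f
    𝓓-minimal ∂-closed V⊆W = go
      where
      go : ∀ {f} → 𝓓 V f → W f
      go (incl f∈)      = V⊆W f∈
      go (resp f≈g f∈)  = Sub.resp f≈g (go f∈)
      go zero∈          = Sub.zero∈
      go (+∈ f∈ g∈)     = Sub.+∈ (go f∈) (go g∈)
      go (·∈ α f∈)      = Sub.·∈ α (go f∈)
      go (∂∈ i j f∈)    = ∂-closed i j (go f∈)

    𝓔-minimal : (∀ i k p → 1 ≤ p → ∀ {f} → W f → W (E i k p f)) → (∀ {f} → V f → W f) → ∀ {f} → 𝓔 V f → W f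
    𝓔-minimal E-closed V⊆W = go
      where
      go : ∀ {f} → 𝓔 V f → W f
      go (incl f∈)          = V⊆W f∈
      go (resp f≈g f∈)      = Sub.resp f≈g (go f∈)
      go zero∈              = Sub.zero∈
      go (+∈ f∈ g∈)         = Sub.+∈ (go f∈) (go g∈)
      go (·∈ α f∈)          = Sub.·∈ α (go f∈)
      go (E∈ i k p p≥1 f∈)  = E-closed i k p p≥1 (go f∈)

  preimage-subspace : ∀ {w T} {W : Polynomial → Set w} → IsLinear T → IsSubspace W → IsSubspace (λ f → W (T f))
  preimage-subspace {T = T} T-linear W-subspace = record
    { resp  = λ f≈g → Sub.resp (coeff≈ (cong-≋ T-linear (mk≋ f≈g)))
    ; zero∈ = Sub.resp (coeff≈ (≋-sym (linear-[] T-linear))) Sub.zero∈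
    ; +∈    = λ {f} {g} Tf∈ Tg∈ → Sub.resp (coeff≈ (≋-sym (hom-++ T-linear f g))) (Sub.+∈ Tf∈ Tg∈)
    ; ·∈    = λ α {f} Tf∈ → Sub.resp (coeff≈ (≋-sym (hom-· T-linear α f))) (Sub.·∈ α Tf∈) }
    where module Sub = IsSubspace W-subspace

  ×-subspace : ∀ {w₁ w₂} {W₁ : Polynomial → Set w₁} {W₂ : Polynomial → Set w₂} →
    IsSubspace W₁ → IsSubspace W₂ → IsSubspace (λ f → W₁ f × W₂ f)
  ×-subspace W₁-subspace W₂-subspace = record
    { resp  = λ f≈g (f∈₁ , f∈₂) → Sub₁.resp f≈g f∈₁ , Sub₂.resp f≈g f∈₂
    ; zero∈ = Sub₁.zero∈ , Sub₂.zero∈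
    ; +∈    = λ (f∈₁ , f∈₂) (g∈₁ , g∈₂) → Sub₁.+∈ f∈₁ g∈₁ , Sub₂.+∈ f∈₂ g∈₂
    ; ·∈    = λ α (f∈₁ , f∈₂) → Sub₁.·∈ α f∈₁ , Sub₂.·∈ α f∈₂ }
    where
    module Sub₁ = IsSubspace W₁-subspace
    module Sub₂ = IsSubspace W₂-subspace

  ⋂-subspace : ∀ {w} {I : Set} {W : I → Polynomial → Set w} →
    (∀ x → IsSubspace (W x)) → IsSubspace (λ f → ∀ x → W x f)
  ⋂-subspace W-subspace = record
    { resp  = λ f≈g f∈ x → IsSubspace.resp (W-subspace x) f≈g (f∈ x)
    ; zero∈ = λ x → IsSubspace.zero∈ (W-subspace x)
    ; +∈    = λ f∈ g∈ x → IsSubspace.+∈ (W-subspace x) (f∈ x) (g∈ x)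
    ; ·∈    = λ α f∈ x → IsSubspace.·∈ (W-subspace x) α (f∈ x) }

  𝓓-closed-∂^ : ∀ {v} {V : Polynomial → Set v} p k b {g} → 𝓓 V g → 𝓓 V (∂^ p k b g)
  𝓓-closed-∂^ zero    k b g∈ = g∈
  𝓓-closed-∂^ (suc p) k b g∈ = ∂∈ k b (𝓓-closed-∂^ p k b g∈)

  -- If X is closed under E_{i,k}^{(p)}, so is 𝓓(X).  By induction over 𝓓(X) for
  -- the pair (g, E g): by the Leibniz rule E(∂_ab g) = ∂_ab(E g) - δ_ai ∂_kb^p g.
  𝓓-preserves-E : ∀ {v} {X : Polynomial → Set v} i k p →
    (∀ {g} → X g → X (E i k p g)) → ∀ {g} → 𝓓 X g → 𝓓 X (E i k p g)
  𝓓-preserves-E {X = X} i k p E-closed g∈ =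
    proj₂ (𝓓-minimal pair-subspace ∂-step (λ x → incl x , incl (E-closed x)) g∈)
    where
    pair-subspace : IsSubspace (λ g → 𝓓 X g × 𝓓 X (E i k p g))
    pair-subspace = ×-subspace (𝓓-isSubspace X) (preimage-subspace (E-linear i k p) (𝓓-isSubspace X))

    commutator : ∀ a b g → ∂ a b (E i k p g) ++ (- 1#) ·P correction a i b k p g ≋ E i k p (∂ a b g)
    commutator a b g = ≋-trans (++-cong (∂-E a b i k p g) ≋-refl) (++-cancel _ _)

    ∂-step : ∀ a b {g} → 𝓓 X g × 𝓓 X (E i k p g) → 𝓓 X (∂ a b g) × 𝓓 X (E i k p (∂ a b g))
    ∂-step a b {g} (g∈ , Eg∈) = ∂∈ a b g∈ , resp (coeff≈ (commutator a b g))
      (+∈ (∂∈ a b Eg∈) (·∈ (- 1#) (correction-elim (𝓓 X) a i b k p g (𝓓-closed-∂^ p k b g∈) zero∈)))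

  ∂s : List (Fin ℓ × Fin n) → Polynomial → Polynomial
  ∂s []             g = g
  ∂s ((a , b) ∷ ds) g = ∂s ds (∂ a b g)

  ∂s-linear : ∀ ds → IsLinear (∂s ds)
  ∂s-linear []             = id-linear
  ∂s-linear ((a , b) ∷ ds) = ∘-linear (∂s-linear ds) (∂-linear a b)

  ∂s-replicate : ∀ p k b ds g → ∂s (replicate p (k , b) ++ ds) g ≡ ∂s ds (∂^ p k b g)
  ∂s-replicate zero    k b ds g = ≡.refl
  ∂s-replicate (suc p) k b ds g = ≡.trans (∂s-replicate p k b ds (∂ k b g)) (≡.cong (∂s ds) (∂^-∂ p))
    where
    ∂^-∂ : ∀ p → ∂^ p k b (∂ k b g) ≡ ∂ k b (∂^ p k b g)
    ∂^-∂ zero    = ≡.refl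
    ∂^-∂ (suc p) = ≡.cong (∂ k b) (∂^-∂ p)

  derivatives-of-E : ∀ {v} {X : Polynomial → Set v} → IsSubspace X → ∀ i k p →
    (∀ {g} → X g → X (E i k p g)) →
    ∀ {g} → (∀ ds → X (∂s ds g)) → ∀ ds → X (∂s ds (E i k p g))
  derivatives-of-E X-subspace i k p E-closed all∈ [] = E-closed (all∈ [])
  derivatives-of-E {X = X} X-subspace i k p E-closed {g} all∈ ((a , b) ∷ ds) =
    Sub.resp (coeff≈ (≋-sym expand))
      (Sub.+∈ (derivatives-of-E X-subspace i k p E-closed (λ ds′ → all∈ ((a , b) ∷ ds′)) ds) correction∈)
    where
    module Sub = IsSubspace X-subspace
    expand : ∂s ds (∂ a b (E i k p g)) ≋ ∂s ds (E i k p (∂ a b g)) ++ ∂s ds (correction a i b k p g)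
    expand = ≋-trans (cong-≋ (∂s-linear ds) (∂-E a b i k p g)) (hom-++ (∂s-linear ds) _ _)
    correction∈ : X (∂s ds (correction a i b k p g))
    correction∈ = correction-elim (λ h → X (∂s ds h)) a i b k p g
      (≡.subst X (∂s-replicate p k b ds g) (all∈ (replicate p (k , b) ++ ds)))
      (Sub.resp (coeff≈ (≋-sym (linear-[] (∂s-linear ds)))) Sub.zero∈)

  -- If Y is closed under all derivatives, so is 𝓔(Y): by induction over 𝓔(Y) for
  -- the statement "all iterated derivatives lie in 𝓔(Y)".
  𝓔-preserves-∂ : ∀ {v} {Y : Polynomial → Set v} →
    (∀ a b {g} → Y g → Y (∂ a b g)) → ∀ a b {g} → 𝓔 Y g → 𝓔 Y (∂ a b g)
  𝓔-preserves-∂ {Y = Y} ∂-closed a b g∈ =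
    𝓔-minimal all-subspace
      (λ i k p p≥1 → derivatives-of-E (𝓔-isSubspace Y) i k p (E∈ i k p p≥1))
      (λ y ds → incl (∂s-closed ds y)) g∈ ((a , b) ∷ [])
    where
    all-subspace : IsSubspace (λ g → ∀ ds → 𝓔 Y (∂s ds g))
    all-subspace = ⋂-subspace (λ ds → preimage-subspace (∂s-linear ds) (𝓔-isSubspace Y))
    ∂s-closed : ∀ ds {g} → Y g → Y (∂s ds g)
    ∂s-closed []             y = y
    ∂s-closed ((a , b) ∷ ds) y = ∂s-closed ds (∂-closed a b y)

  𝓔𝓓⊆𝓓𝓔 : ∀ {v} (V : Polynomial → Set v) {f} → 𝓔 (𝓓 V) f → 𝓓 (𝓔 V) f
  𝓔𝓓⊆𝓓𝓔 V = 𝓔-minimal (𝓓-isSubspace (𝓔 V))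
    (λ i k p p≥1 → 𝓓-preserves-E i k p (E∈ i k p p≥1))
    (𝓓-minimal (𝓓-isSubspace (𝓔 V)) ∂∈ (λ v → incl (incl v)))

  𝓓𝓔⊆𝓔𝓓 : ∀ {v} (V : Polynomial → Set v) {f} → 𝓓 (𝓔 V) f → 𝓔 (𝓓 V) f
  𝓓𝓔⊆𝓔𝓓 V = 𝓓-minimal (𝓔-isSubspace (𝓓 V))
    (𝓔-preserves-∂ ∂∈)
    (𝓔-minimal (𝓔-isSubspace (𝓓 V)) (λ i k p p≥1 → E∈ i k p p≥1) (λ v → incl (incl v)))

-- The theorem: 𝓔(𝓓(V)) = 𝓓(𝓔(V)) for every V.
mainTheorem1 : ∀ {c r a : Level} (F : CharZeroField c r) (ℓ n : ℕ) → 1 ≤ n → 1 ≤ ℓ →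
    (V : Poly.Polynomial F ℓ n → Set a) →
    Poly.IsSubspace F ℓ n V → Poly.IsHomogeneous F ℓ n V →
    ∀ f → ((Poly.𝓔 F ℓ n (Poly.𝓓 F ℓ n V) f → Poly.𝓓 F ℓ n (Poly.𝓔 F ℓ n V) f)
         × (Poly.𝓓 F ℓ n (Poly.𝓔 F ℓ n V) f → Poly.𝓔 F ℓ n (Poly.𝓓 F ℓ n V) f))
mainTheorem1 F ℓ n _ _ V _ _ f = Development.𝓔𝓓⊆𝓓𝓔 F ℓ n V , Development.𝓓𝓔⊆𝓔𝓓 F ℓ n V
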